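{- Let $G$ be a finite simple graph, $v_0 \in V(G)$, and $P$ a longest $v_0$-path in $G$. For every $v \in L(G,P,v_0)$, we have $|S_v| \leq c(v) - |L(G,P,v_0)|$, where $S_v = N(v) \setminus L(G,P,v_0)$.
   Context: $N(v)$ is the set of neighbours of $v$. For $v\in V(G)$, $c(v)$ is the length of the longest cycle containing $v$, or $2$ if $v$ is on no cycle. A $v_0$-path is a path starting at $v_0$; its other end is its terminal vertex; a longest $v_0$-path is one of maximum length among $v_0$-paths. If $Q = v_0v_1\dots v_k$ is a longest $v_0$-path and $v_k$ is adjacent to $v_j$ for some $0 \le j \le k-2$, the path $v_0v_1\dots v_jv_kv_{k-1}\dots v_{j+1}$ is a simple transform of $Q$. A transform of $P$ is any path obtained from $P$ by a finite sequence of simple transforms. $L(G,P,v_0)$ is the set of terminal vertices of transforms of $P$. -}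

module Defs where

open import Data.Nat using (ℕ; _≤_; _+_)
open import Data.Bool using (Bool; true; false)
open import Data.Fin using (Fin)
open import Data.Fin.Subset using (Subset; _∈_; _─_; ∣_∣)
open import Data.Vec using (tabulate)
open import Data.List using (List; []; _∷_; _∷ʳ_; _++_; reverse; length; last)
open import Data.List.Relation.Unary.Unique.Propositional using (Unique)
import Data.List.Membership.Propositional as LM
open import Data.Maybe using (Maybe; just)
open import Data.Product using (Σ; ∃; ∃-syntax; _×_)
open import Data.Sum using (_⊎_)
open import Relation.Nullary using (¬_)
open import Relation.Binary.PropositionalEquality using (_≡_; _≢_)
open import Function.Bundles using (_⇔_)

record Graph (n : ℕ) : Set where
  field
    adj   : Fin n → Fin n → Bool
    sym   : ∀ u v → adj u v ≡ adj v u
    irrefl : ∀ v → adj v v ≡ false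
open Graph public

module _ {n : ℕ} (G : Graph n) where

  Adj : Fin n → Fin n → Set
  Adj u v = adj G u v ≡ true

  N : Fin n → Subset n
  N v = tabulate (adj G v)

  data Walk : List (Fin n) → Set where
    walk[]  : Walk []
    walk[_] : ∀ x → Walk (x ∷ [])
    walk∷   : ∀ {x y xs} → Adj x y → Walk (y ∷ xs) → Walk (x ∷ y ∷ xs)

  IsPath : List (Fin n) → Set
  IsPath xs = Walk xs × Unique xs

  IsV0Path : Fin n → List (Fin n) → Set
  IsV0Path v0 Q = Σ (List (Fin n)) λ rest → (Q ≡ v0 ∷ rest) × IsPath Q

  -- a longest v0-path (lengths compared by number of vertices, equivalently edges)
  IsLongestV0Path : Fin n → List (Fin n) → Set
  IsLongestV0Path v0 Q = IsV0Path v0 Q × (∀ R → IsV0Path v0 R → length R ≤ length Q)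

  -- simple transform: Q = v0..vj v(j+1)..vk  (j ≤ k-2, vk ~ vj)
  -- ↦ v0..vj vk v(k-1)..v(j+1).  Here pre = ps ∷ʳ a (ending in vj),
  -- rest = bs ∷ʳ b with bs nonempty (so rest has ≥ 2 vertices), b = vk.
  SimpleTransform : Fin n → List (Fin n) → List (Fin n) → Set
  SimpleTransform v0 Q Q' =
    IsLongestV0Path v0 Q ×
    ∃[ ps ] ∃[ a ] ∃[ bs ] ∃[ b ]
      (bs ≢ []) × (Q ≡ (ps ∷ʳ a) ++ (bs ∷ʳ b)) × Adj b a ×
      (Q' ≡ (ps ∷ʳ a) ++ (b ∷ reverse bs))

  data Transform (v0 : Fin n) : List (Fin n) → List (Fin n) → Set where
    done : ∀ {Q} → Transform v0 Q Q
    step : ∀ {Q Q' Q''} → SimpleTransform v0 Q Q' → Transform v0 Q' Q'' → Transform v0 Q Q''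

  InL : Fin n → List (Fin n) → Fin n → Set
  InL v0 P v = ∃[ Q ] Transform v0 P Q × (last Q ≡ just v)

  IsLSet : Fin n → List (Fin n) → Subset n → Set
  IsLSet v0 P Lset = ∀ v → (v ∈ Lset) ⇔ InL v0 P v

  IsCycle : List (Fin n) → Set
  IsCycle C = (3 ≤ length C) × IsPath C ×
              (∃[ x ] ∃[ y ] (∃[ xs ] C ≡ x ∷ xs) × (last C ≡ just y) × Adj y x)

  CycleThrough : Fin n → List (Fin n) → Set
  CycleThrough v C = IsCycle C × v LM.∈ C

  IsC : Fin n → ℕ → Set
  IsC v k =
    (∃[ C ] CycleThrough v C × length C ≡ k × (∀ D → CycleThrough v D → length D ≤ k))
    ⊎ ((∀ C → ¬ CycleThrough v C) × k ≡ 2)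

-- Let u be the first vertex of P that lies in L or has a neighbour in L, and
-- write P = pre ++ u ∷ T.  A simple transform reverses the segment after a
-- neighbour of the current terminal vertex, which lies in L; hence it never
-- touches pre ++ [ u ], and every transform of P has the form pre ++ u ∷ T′
-- with T′ a permutation of T.  So L ⊆ u ∷ T, and also N(v) ⊆ u ∷ T, because a
-- longest path contains every neighbour of its terminal vertex v and no vertex
-- of pre is adjacent to v.  Thus |N(v) ─ L| + |L| = |N(v) ∪ L| ≤ |u ∷ T|.
-- Finally |u ∷ T| ≤ c(v): if u ∈ L, the transform ending at u forces T = [];
-- otherwise u is adjacent to the terminal vertex x ∈ L of some transform
-- pre ++ u ∷ T′, and u ∷ T′ closes up into a cycle through v.

module Submission where

open import Defs hiding (sym)
open import Data.Nat using (ℕ; _≤_; _+_; suc; s≤s; s≤s⁻¹; _≤?_)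
open import Data.Nat.Properties using (≤-trans; ≤-refl; ≤-reflexive; n≤1+n; +-comm; +-suc; ≰⇒>; m+1+n≰m; module ≤-Reasoning)
open import Data.Fin using (Fin)
import Data.Fin as Fin
open import Data.Fin.Properties using (any?)
open import Data.Fin.Subset using (Subset; _∈_; _∉_; _─_; _∪_; _-_; ⁅_⁆; ∣_∣; inside; outside; Empty)
open import Data.Fin.Subset.Properties
  using (∣p∣≤∣p∪q∣; ∣⁅x⁆∣≡1; ∣⊥∣≡0; Empty-unique; p─q⊆p; x∈⁅x⁆; x∈p∪q⁻; _∈?_)
open import Data.Bool using (true)
import Data.Bool.Properties as Bool
open import Data.Vec using ([]; _∷_)
open import Data.Vec.Properties using ([]=⇒lookup; lookup∘tabulate)
open import Data.Vec.Base using (here; there)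
open import Data.List using (List; []; _∷_; _∷ʳ_; _++_; [_]; reverse; reverseAcc; length; last)
open import Data.List.Properties using (++-assoc; ∷-injective; reverse-++; length-++)
open import Data.List.Membership.Propositional using (lose) renaming (_∈_ to _∈ₗ_; _∉_ to _∉ₗ_)
open import Data.List.Membership.Propositional.Properties using (∈-++⁻)
import Data.List.Membership.DecPropositional as DecMembership
open import Data.List.Relation.Unary.Any using (Any; here; there)
open import Data.List.Relation.Unary.All using (All; [])
import Data.List.Relation.Unary.All as All
open import Data.List.Relation.Unary.All.Properties using (All¬⇒¬Any)
open import Data.List.Relation.Unary.First using () renaming (_++_∷_ to _⊢_∷_)
import Data.List.Relation.Unary.First as First
open import Data.List.Relation.Unary.First.Properties using (toView)
open import Data.List.Relation.Unary.AllPairs using ([]; _∷_)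
open import Data.List.Relation.Unary.Unique.Propositional using (Unique)
import Data.List.Relation.Unary.Unique.Propositional.Properties as Unique
open import Data.List.Relation.Binary.Permutation.Propositional using (_↭_; ↭-refl; ↭-sym; ↭-trans; prep; ↭⇒↭ₛ)
open import Data.List.Relation.Binary.Permutation.Propositional.Properties using (∈-resp-↭; ↭-length; ++⁺ˡ; ↭-reverse)
import Data.List.Relation.Binary.Permutation.Setoid.Properties as PermutationSetoid
open import Data.Maybe using (just)
open import Data.Product using (∃-syntax; _×_; _,_; -,_)
open import Data.Sum using (_⊎_; inj₁; inj₂)
import Data.Sum as Sum
open import Data.Empty using (⊥-elim)
open import Relation.Nullary using (yes; no)
open import Relation.Nullary.Decidable using (toSum; _×-dec_; _⊎-dec_)
open import Relation.Unary using (Pred; Decidable; ∁)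
open import Relation.Binary.PropositionalEquality using (_≡_; refl; sym; trans; cong; subst; setoid)
open import Function.Base using (_∘_)
open import Function.Bundles using (Equivalence)

∣p─q∣+∣q∣≡∣p∪q∣ : ∀ {n} (p q : Subset n) → ∣ p ─ q ∣ + ∣ q ∣ ≡ ∣ p ∪ q ∣
∣p─q∣+∣q∣≡∣p∪q∣ []            []            = refl
∣p─q∣+∣q∣≡∣p∪q∣ (inside  ∷ p) (inside  ∷ q) = trans (+-suc ∣ p ─ q ∣ ∣ q ∣) (cong suc (∣p─q∣+∣q∣≡∣p∪q∣ p q))
∣p─q∣+∣q∣≡∣p∪q∣ (outside ∷ p) (inside  ∷ q) = trans (+-suc ∣ p ─ q ∣ ∣ q ∣) (cong suc (∣p─q∣+∣q∣≡∣p∪q∣ p q))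
∣p─q∣+∣q∣≡∣p∪q∣ (inside  ∷ p) (outside ∷ q) = cong suc (∣p─q∣+∣q∣≡∣p∪q∣ p q)
∣p─q∣+∣q∣≡∣p∪q∣ (outside ∷ p) (outside ∷ q) = ∣p─q∣+∣q∣≡∣p∪q∣ p q

x∈p─q⇒x∉q : ∀ {n} {x : Fin n} {p q : Subset n} → x ∈ p ─ q → x ∉ q
x∈p─q⇒x∉q {p = _ ∷ p} {_ ∷ q} (there x∈p─q) (there x∈q) = x∈p─q⇒x∉q x∈p─q x∈q

∣p∣≤length : ∀ {n} {p : Subset n} (xs : List (Fin n)) → (∀ {x} → x ∈ p → x ∈ₗ xs) → ∣ p ∣ ≤ length xs
∣p∣≤length {n} {p} [] p⊆[] = ≤-reflexive (trans (cong ∣_∣ (Empty-unique p-empty)) (∣⊥∣≡0 n))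
  where
  p-empty : Empty p
  p-empty (_ , x∈p) with p⊆[] x∈p
  ... | ()
∣p∣≤length {p = p} (x ∷ xs) p⊆x∷xs = begin
  ∣ p ∣                 ≤⟨ ∣p∣≤∣p∪q∣ p ⁅ x ⁆ ⟩
  ∣ p ∪ ⁅ x ⁆ ∣         ≡⟨ sym (∣p─q∣+∣q∣≡∣p∪q∣ p ⁅ x ⁆) ⟩
  ∣ p - x ∣ + ∣ ⁅ x ⁆ ∣ ≡⟨ cong (∣ p - x ∣ +_) (∣⁅x⁆∣≡1 x) ⟩
  ∣ p - x ∣ + 1         ≡⟨ +-comm _ 1 ⟩
  suc ∣ p - x ∣         ≤⟨ s≤s (∣p∣≤length xs p-x⊆xs) ⟩
  suc (length xs)       ∎
  where
  open ≤-Reasoning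
  p-x⊆xs : ∀ {y} → y ∈ p - x → y ∈ₗ xs
  p-x⊆xs y∈p-x with p⊆x∷xs (p─q⊆p p ⁅ x ⁆ y∈p-x)
  ... | here refl  = ⊥-elim (x∈p─q⇒x∉q y∈p-x (x∈⁅x⁆ x))
  ... | there y∈xs = y∈xs

module _ {a} {A : Set a} where

  last-++-∷ : ∀ (xs : List A) y ys → last (xs ++ y ∷ ys) ≡ last (y ∷ ys)
  last-++-∷ []           y ys = refl
  last-++-∷ (_ ∷ [])     y ys = refl
  last-++-∷ (_ ∷ x ∷ xs) y ys = last-++-∷ (x ∷ xs) y ys

  last-∷ʳ : ∀ (xs : List A) y → last (xs ∷ʳ y) ≡ just y
  last-∷ʳ xs y = last-++-∷ xs y []

  last-++-∷ʳ : ∀ (xs ys : List A) y → last (xs ++ ys ∷ʳ y) ≡ just y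
  last-++-∷ʳ xs ys y = trans (cong last (sym (++-assoc xs ys [ y ]))) (last-∷ʳ (xs ++ ys) y)

  last⇒∈ : ∀ (xs : List A) {y} → last xs ≡ just y → y ∈ₗ xs
  last⇒∈ (_ ∷ [])     refl = here refl
  last⇒∈ (_ ∷ x ∷ xs) eq   = there (last⇒∈ (x ∷ xs) eq)

  Unique-++⁻ʳ : ∀ (xs : List A) {ys} → Unique (xs ++ ys) → Unique ys
  Unique-++⁻ʳ []       u       = u
  Unique-++⁻ʳ (_ ∷ xs) (_ ∷ u) = Unique-++⁻ʳ xs u

  Unique∧last≡head⇒[] : ∀ {x : A} {xs} → Unique (x ∷ xs) → last (x ∷ xs) ≡ just x → xs ≡ []
  Unique∧last≡head⇒[] {xs = []}     _          _  = refl
  Unique∧last≡head⇒[] {xs = y ∷ ys} (x∉ys ∷ _) eq =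
    ⊥-elim (All.lookup x∉ys (last⇒∈ (y ∷ ys) eq) refl)

  ∷-reverse↭∷ʳ : ∀ (xs : List A) x → x ∷ reverse xs ↭ xs ∷ʳ x
  ∷-reverse↭∷ʳ xs x = subst (_↭ xs ∷ʳ x) (reverse-++ xs [ x ]) (↭-reverse (xs ∷ʳ x))

  head-∷ʳ-++ : ∀ (xs : List A) {x y : A} {zs zs′ ys} → (xs ∷ʳ x) ++ zs ≡ y ∷ ys →
               ∃[ ys′ ] (xs ∷ʳ x) ++ zs′ ≡ y ∷ ys′
  head-∷ʳ-++ []       refl = -, refl
  head-∷ʳ-++ (_ ∷ xs) refl = -, refl

  ∷ʳ-++-split : ∀ (pre xs : List A) {x u : A} {ys zs} → x ∉ₗ pre →
                pre ++ u ∷ ys ≡ (xs ∷ʳ x) ++ zs →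
                ∃[ ms ] xs ∷ʳ x ≡ pre ++ u ∷ ms × ys ≡ ms ++ zs
  ∷ʳ-++-split []        []       _     refl = [] , refl , refl
  ∷ʳ-++-split []        (_ ∷ xs) _     refl = xs ∷ʳ _ , refl , refl
  ∷ʳ-++-split (_ ∷ _)   []       x∉pre refl = ⊥-elim (x∉pre (here refl))
  ∷ʳ-++-split (_ ∷ pre) (_ ∷ xs) x∉pre eq with ∷-injective eq
  ... | refl , eq′ with ∷ʳ-++-split pre xs (x∉pre ∘ there) eq′
  ...   | ms , eq₁ , eq₂ = ms , cong (_ ∷_) eq₁ , eq₂

  split-at-first : ∀ {p} {P : Pred A p} → Decidable P → ∀ {xs} → Any P xs →
                   ∃[ pre ] ∃[ u ] ∃[ ys ] xs ≡ pre ++ u ∷ ys × All (∁ P) pre × P u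
  split-at-first P? {xs} any with First.first (λ x → Sum.swap (toSum (P? x))) xs
  ... | inj₂ none = ⊥-elim (All¬⇒¬Any none any)
  ... | inj₁ first with toView first
  ... | far ⊢ pu ∷ ys = -, -, ys , refl , far , pu

module _ {n : ℕ} (G : Graph n) where

  open DecMembership (Fin._≟_ {n}) using () renaming (_∈?_ to _∈ₗ?_)
  open PermutationSetoid (setoid (Fin n)) using (Unique-resp-↭)

  Adj-sym : ∀ {x y} → Adj G x y → Adj G y x
  Adj-sym {x} {y} x~y = trans (Graph.sym G y x) x~y

  ∈N⇒Adj : ∀ {x y} → y ∈ N G x → Adj G x y
  ∈N⇒Adj {x} {y} y∈Nx = trans (sym (lookup∘tabulate (adj G x) y)) ([]=⇒lookup y∈Nx)

  Walk-++⁻ˡ : ∀ xs {ys} → Walk G (xs ++ ys) → Walk G xs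
  Walk-++⁻ˡ []           _           = walk[]
  Walk-++⁻ˡ (x ∷ [])     _           = walk[ x ]
  Walk-++⁻ˡ (_ ∷ y ∷ xs) (walk∷ a w) = walk∷ a (Walk-++⁻ˡ (y ∷ xs) w)

  Walk-++⁻ʳ : ∀ xs {ys} → Walk G (xs ++ ys) → Walk G ys
  Walk-++⁻ʳ []           w           = w
  Walk-++⁻ʳ (_ ∷ [])     walk[ _ ]   = walk[]
  Walk-++⁻ʳ (_ ∷ [])     (walk∷ _ w) = w
  Walk-++⁻ʳ (_ ∷ y ∷ xs) (walk∷ _ w) = Walk-++⁻ʳ (y ∷ xs) w

  Walk-++⁺ : ∀ {xs x y ys} → Walk G xs → last xs ≡ just x → Adj G x y → Walk G (y ∷ ys) →
             Walk G (xs ++ y ∷ ys)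
  Walk-++⁺ walk[ _ ]   refl x~y w′ = walk∷ x~y w′
  Walk-++⁺ (walk∷ a w) eq   x~y w′ = walk∷ a (Walk-++⁺ w eq x~y w′)

  Walk-reverseAcc : ∀ acc {x xs} → Walk G (x ∷ acc) → Walk G (x ∷ xs) → Walk G (reverseAcc acc (x ∷ xs))
  Walk-reverseAcc acc wacc walk[ _ ]   = wacc
  Walk-reverseAcc acc wacc (walk∷ a w) = Walk-reverseAcc (_ ∷ acc) (walk∷ (Adj-sym a) wacc) w

  Walk-reverse : ∀ {xs} → Walk G xs → Walk G (reverse xs)
  Walk-reverse {[]}    w = w
  Walk-reverse {x ∷ _} w = Walk-reverseAcc [] walk[ x ] w

  longest-↭ : ∀ {v0 Q Q′} → IsLongestV0Path G v0 Q → Q′ ↭ Q → ∃[ rest ] Q′ ≡ v0 ∷ rest → Walk G Q′ →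
              IsLongestV0Path G v0 Q′
  longest-↭ ((_ , _ , _ , uQ) , maximal) Q′↭Q (rest , Q′≡) wQ′ =
    (rest , Q′≡ , wQ′ , Unique-resp-↭ (↭⇒↭ₛ (↭-sym Q′↭Q)) uQ) ,
    λ R R-path → subst (length R ≤_) (sym (↭-length Q′↭Q)) (maximal R R-path)

  longest-terminal-Adj⇒∈ : ∀ {v0 R x y} → IsLongestV0Path G v0 R → last R ≡ just x → Adj G x y → y ∈ₗ R
  longest-terminal-Adj⇒∈ {v0} {R} {y = y} ((rest , R≡ , wR , uR) , maximal) last≡ x~y with y ∈ₗ? R
  ... | yes y∈R = y∈R
  ... | no  y∉R = ⊥-elim (m+1+n≰m (length R) (subst (_≤ length R) (length-++ R) (maximal (R ∷ʳ y) extension)))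
    where
    extension : IsV0Path G v0 (R ∷ʳ y)
    extension = rest ∷ʳ y , cong (_∷ʳ y) R≡ , Walk-++⁺ wR last≡ x~y walk[ y ] ,
                Unique.++⁺ uR ([] ∷ []) λ { (y∈R , here refl) → y∉R y∈R }

  simpleTransform-↭ : ∀ {v0 Q Q′} → SimpleTransform G v0 Q Q′ → Q′ ↭ Q
  simpleTransform-↭ (_ , ps , a , bs , b , _ , refl , _ , refl) = ++⁺ˡ (ps ∷ʳ a) (∷-reverse↭∷ʳ bs b)

  simpleTransform-longest : ∀ {v0 Q Q′} → SimpleTransform G v0 Q Q′ → IsLongestV0Path G v0 Q′
  simpleTransform-longest st@(Q-longest@((_ , Q≡ , wQ , _) , _) , ps , a , bs , b , _ , refl , b~a , refl) =
    longest-↭ Q-longest (simpleTransform-↭ st) (head-∷ʳ-++ ps Q≡)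
      (Walk-++⁺ (Walk-++⁻ˡ (ps ∷ʳ a) wQ) (last-∷ʳ ps a) (Adj-sym b~a) reversed-tail)
    where
    reversed-tail : Walk G (b ∷ reverse bs)
    reversed-tail = subst (Walk G) (reverse-++ bs [ b ]) (Walk-reverse (Walk-++⁻ʳ (ps ∷ʳ a) wQ))

  transform-↭ : ∀ {v0 Q R} → Transform G v0 Q R → R ↭ Q
  transform-↭ done        = ↭-refl
  transform-↭ (step st t) = ↭-trans (transform-↭ t) (simpleTransform-↭ st)

  transform-longest : ∀ {v0 Q R} → IsLongestV0Path G v0 Q → Transform G v0 Q R → IsLongestV0Path G v0 R
  transform-longest Q-longest done        = Q-longest
  transform-longest _         (step st t) = transform-longest (simpleTransform-longest st) t

  simpleTransform-preserves-prefix : ∀ {v0 pre u T Q′} →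
    (∀ {b a} → last (pre ++ u ∷ T) ≡ just b → Adj G b a → a ∉ₗ pre) →
    SimpleTransform G v0 (pre ++ u ∷ T) Q′ → ∃[ T′ ] Q′ ≡ pre ++ u ∷ T′ × T′ ↭ T
  simpleTransform-preserves-prefix {pre = pre} {u} away (_ , ps , a , bs , b , _ , Q≡ , b~a , refl)
    with ∷ʳ-++-split pre ps (away (subst (λ Q → last Q ≡ just b) (sym Q≡) (last-++-∷ʳ (ps ∷ʳ a) bs b)) b~a) Q≡
  ... | ms , ps∷ʳa≡ , refl =
    ms ++ b ∷ reverse bs ,
    trans (cong (_++ b ∷ reverse bs) ps∷ʳa≡) (++-assoc pre (u ∷ ms) (b ∷ reverse bs)) ,
    ++⁺ˡ ms (∷-reverse↭∷ʳ bs b)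

  transform-preserves-prefix : ∀ {v0 pre u T R} →
    (∀ {Q b a} → Transform G v0 (pre ++ u ∷ T) Q → last Q ≡ just b → Adj G b a → a ∉ₗ pre) →
    Transform G v0 (pre ++ u ∷ T) R → ∃[ T′ ] R ≡ pre ++ u ∷ T′ × T′ ↭ T
  transform-preserves-prefix away done = -, refl , ↭-refl
  transform-preserves-prefix away (step st t) with simpleTransform-preserves-prefix (away done) st
  ... | T₁ , refl , T₁↭T with transform-preserves-prefix (λ t′ → away (step st t′)) t
  ...   | T′ , R≡ , T′↭T₁ = T′ , R≡ , ↭-trans T′↭T₁ T₁↭T

  2≤c : ∀ {v k} → IsC G v k → 2 ≤ k
  2≤c (inj₁ (_ , ((3≤∣C∣ , _) , _) , refl , _)) = ≤-trans (n≤1+n 2) 3≤∣C∣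
  2≤c (inj₂ (_ , refl))                          = ≤-refl

  cycle-length≤c : ∀ {v k C} → CycleThrough G v C → IsC G v k → length C ≤ k
  cycle-length≤c C∋v (inj₁ (_ , _ , _ , longest)) = longest _ C∋v
  cycle-length≤c C∋v (inj₂ (acyclic , _))        = ⊥-elim (acyclic _ C∋v)

  closedPath-length≤c : ∀ {v k u x T} → IsPath G (u ∷ T) → last (u ∷ T) ≡ just x → Adj G x u →
                        v ∈ₗ u ∷ T → IsC G v k → length (u ∷ T) ≤ k
  closedPath-length≤c {u = u} {T = T} path last≡ x~u v∈uT c with 3 ≤? length (u ∷ T)
  ... | yes 3≤ = cycle-length≤c ((3≤ , path , (-, -, (T , refl) , last≡ , x~u)) , v∈uT) c
  ... | no  3≰ = ≤-trans (s≤s⁻¹ (≰⇒> 3≰)) (2≤c c)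

  Near : Subset n → Fin n → Set
  Near L y = y ∈ L ⊎ ∃[ x ] x ∈ L × Adj G x y

  near? : ∀ L → Decidable (Near L)
  near? L y = (y ∈? L) ⊎-dec any? (λ x → (x ∈? L) ×-dec (adj G x y Bool.≟ true))

  module _ {v0 P L} (isL : IsLSet G v0 P L) where

    ∈L⇒terminal : ∀ {y} → y ∈ L → ∃[ R ] Transform G v0 P R × last R ≡ just y
    ∈L⇒terminal = Equivalence.to (isL _)

    terminal⇒∈L : ∀ {R y} → Transform G v0 P R → last R ≡ just y → y ∈ L
    terminal⇒∈L t last≡ = Equivalence.from (isL _) (-, t , last≡)

    L⊆P : ∀ {y} → y ∈ L → y ∈ₗ P
    L⊆P y∈L with ∈L⇒terminal y∈L
    ... | R , t , last≡ = ∈-resp-↭ (transform-↭ t) (last⇒∈ R last≡)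

  module _ {v0 pre u T L} (P-longest : IsLongestV0Path G v0 (pre ++ u ∷ T))
           (isL : IsLSet G v0 (pre ++ u ∷ T) L) (far : All (∁ (Near L)) pre) where

    transform-shape : ∀ {R} → Transform G v0 (pre ++ u ∷ T) R → ∃[ T′ ] R ≡ pre ++ u ∷ T′ × T′ ↭ T
    transform-shape = transform-preserves-prefix λ t last≡ b~a a∈pre →
      All.lookup far a∈pre (inj₂ (-, terminal⇒∈L isL t last≡ , b~a))

    terminal-segment : ∀ {y} → y ∈ L →
                       ∃[ T′ ] T′ ↭ T × IsPath G (u ∷ T′) × last (u ∷ T′) ≡ just y
    terminal-segment y∈L with ∈L⇒terminal isL y∈L
    ... | R , t , last≡ with transform-shape t | transform-longest P-longest t
    ...   | T′ , refl , T′↭T | (_ , _ , walk , unique) , _ =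
      T′ , T′↭T , (Walk-++⁻ʳ pre walk , Unique-++⁻ʳ pre unique) , trans (sym (last-++-∷ pre u T′)) last≡

    L⊆uT : ∀ {y} → y ∈ L → y ∈ₗ u ∷ T
    L⊆uT y∈L with terminal-segment y∈L
    ... | T′ , T′↭T , _ , last≡ = ∈-resp-↭ (prep u T′↭T) (last⇒∈ (u ∷ T′) last≡)

    N⊆uT : ∀ {v y} → v ∈ L → y ∈ N G v → y ∈ₗ u ∷ T
    N⊆uT v∈L y∈Nv with ∈L⇒terminal isL v∈L
    ... | R , t , last≡ with ∈-++⁻ pre (∈-resp-↭ (transform-↭ t)
                               (longest-terminal-Adj⇒∈ (transform-longest P-longest t) last≡ (∈N⇒Adj y∈Nv)))
    ...   | inj₁ y∈pre = ⊥-elim (All.lookup far y∈pre (inj₂ (-, v∈L , ∈N⇒Adj y∈Nv)))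
    ...   | inj₂ y∈uT  = y∈uT

    length≤c : ∀ {v k} → Near L u → v ∈ L → IsC G v k → length (u ∷ T) ≤ k
    length≤c {k = k} (inj₁ u∈L) v∈L c with terminal-segment u∈L
    ... | T′ , T′↭T , (_ , unique) , last≡ with Unique∧last≡head⇒[] unique last≡
    ...   | refl = subst (λ m → suc m ≤ k) (↭-length T′↭T) (≤-trans (n≤1+n 1) (2≤c c))
    length≤c {k = k} (inj₂ (x , x∈L , x~u)) v∈L c with terminal-segment x∈L
    ... | T′ , T′↭T , path , last≡ =
      subst (λ m → suc m ≤ k) (↭-length T′↭T)
        (closedPath-length≤c path last≡ x~u (∈-resp-↭ (prep u (↭-sym T′↭T)) (L⊆uT v∈L)) c)

lemma2p19 : ∀ {n} (G : Graph n) (v0 : Fin n) (P : List (Fin n)) →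
    IsLongestV0Path G v0 P →
    (Lset : Subset n) → IsLSet G v0 P Lset →
    ∀ v → v ∈ Lset → ∀ k → IsC G v k →
    ∣ N G v ─ Lset ∣ + ∣ Lset ∣ ≤ k
lemma2p19 G v0 P P-longest L isL v v∈L k c
  with split-at-first (near? G L) (lose (L⊆P G isL v∈L) (inj₁ v∈L))
... | pre , u , T , refl , far , u-near = begin
  ∣ N G v ─ L ∣ + ∣ L ∣ ≡⟨ ∣p─q∣+∣q∣≡∣p∪q∣ (N G v) L ⟩
  ∣ N G v ∪ L ∣         ≤⟨ ∣p∣≤length (u ∷ T) N∪L⊆uT ⟩
  length (u ∷ T)        ≤⟨ length≤c G P-longest isL far u-near v∈L c ⟩
  k                     ∎
  where
  open ≤-Reasoning
  N∪L⊆uT : ∀ {y} → y ∈ N G v ∪ L → y ∈ₗ u ∷ T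
  N∪L⊆uT y∈N∪L = Sum.[ N⊆uT G P-longest isL far v∈L , L⊆uT G P-longest isL far ] (x∈p∪q⁻ (N G v) L y∈N∪L)
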